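{- Let $k,m\in\mathbb{N}$ and $a,b\in\{0,1\}$. Let $p$ be a suffix of $\varphi^k(a)$ and $s$ be a prefix of $\varphi^k(b)$. There exists $z\in\{0,1\}^m$ such that $p\,\varphi^k(z)\,s$ is a factor of $\mathbf{t}$.
   Context: $\varphi:\{0,1\}^*\to\{0,1\}^*$ is the morphism $\varphi(0)=01$, $\varphi(1)=10$, and $\mathbf{t}$ is its infinite fixed point starting with $0$ (the Thue--Morse word). A factor is a block of consecutive letters. -}

module Defs where

open import Data.Bool using (Bool; true; false; not)
open import Data.Nat using (ℕ; zero; suc; _+_; _<_)
open import Data.List using (List; []; _∷_; _++_; concatMap; length)
open import Data.Vec using (Vec; toList)
open import Data.Fin using (Fin; toℕ)
open import Data.Product using (∃; ∃-syntax; Σ)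
open import Relation.Binary.PropositionalEquality using (_≡_)
open import Function using (_∘_)

-- Letters: false = 0, true = 1.
Letter : Set
Letter = Bool

Word : Set
Word = List Letter

φ₁ : Letter → Word
φ₁ a = a ∷ not a ∷ []

φ : Word → Word
φ = concatMap φ₁

φ^ : ℕ → Word → Word
φ^ zero    w = w
φ^ (suc k) w = φ (φ^ k w)

-- Indexing with a default (only used on in-range indices).
at : Word → ℕ → Letter
at []      _       = false
at (x ∷ _) zero    = x
at (_ ∷ w) (suc n) = at w n

-- The Thue–Morse word t (fixed point of φ starting with 0):
-- t(n) is the n-th letter of φ^(n+1)(0), which has length 2^(n+1) > n
-- and is a prefix of the fixed point.
t : ℕ → Letter
t n = at (φ^ (suc n) (false ∷ [])) n

IsFactorOfT : Word → Set
IsFactorOfT w = ∃[ i ] (∀ (j : Fin (length w)) → at w (toℕ j) ≡ t (i + toℕ j))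

IsSuffix : Word → Word → Set
IsSuffix p w = ∃[ u ] (u ++ p ≡ w)

IsPrefix : Word → Word → Set
IsPrefix s w = ∃[ v ] (s ++ v ≡ w)

-- Every pair of letters occurs in t at every distance d ≥ 1: since t(2n) = t(n) and
-- t(2n+1) = ¬t(n), for every d there are positions e with t(e+d) = t(e) and with
-- t(e+d) ≠ t(e), and passing to the complement (t(2^N + y) = ¬t(y) for y < 2^N) then
-- fixes the first letter.
-- So a·z·b is a factor of t for some z of length m, hence so is its image
-- φ^k(a) φ^k(z) φ^k(b), which contains p φ^k(z) s.
module Submission where

open import Defs
open import Data.Nat using (ℕ)
open import Data.Bool using (Bool)
open import Data.List using (List; _∷_; []; _++_)
open import Data.Vec using (Vec; toList)
open import Data.Product using (∃-syntax; Σ-syntax)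

open import Data.Bool using (true; false; not; _xor_)
open import Data.Bool.Properties using (not-involutive; not-distribˡ-xor)
open import Data.Fin using (Fin; toℕ; zero; suc)
open import Data.List using (length; map)
open import Data.List.Properties using (++-assoc; concatMap-++)
open import Data.Nat using (zero; suc; _+_; _*_; _^_; _<_; _≤_; _≤′_; ≤′-refl; ≤′-step; z<s; s≤s)
open import Data.Nat.Induction using (<-rec)
open import Data.Nat.Properties
open import Algebra.Properties.CommutativeSemigroup +-commutativeSemigroup using (interchange)
open import Data.Product using (_,_; _×_)
open import Data.Sum using (_⊎_; inj₁; inj₂)
open import Data.Unit using (⊤; tt)
open import Data.Vec using ([]; _∷_)
open import Relation.Binary.PropositionalEquality
open ≡-Reasoning

φ-++ : ∀ u v → φ (u ++ v) ≡ φ u ++ φ v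
φ-++ = concatMap-++ φ₁

φ-map-not : ∀ w → φ (map not w) ≡ map not (φ w)
φ-map-not []      = refl
φ-map-not (x ∷ w) = cong (λ r → not x ∷ not (not x) ∷ r) (φ-map-not w)

φ^-++ : ∀ k u v → φ^ k (u ++ v) ≡ φ^ k u ++ φ^ k v
φ^-++ zero    u v = refl
φ^-++ (suc k) u v = trans (cong φ (φ^-++ k u v)) (φ-++ (φ^ k u) (φ^ k v))

φ^-map-not : ∀ k w → φ^ k (map not w) ≡ map not (φ^ k w)
φ^-map-not zero    w = refl
φ^-map-not (suc k) w = trans (cong φ (φ^-map-not k w)) (φ-map-not (φ^ k w))

φ^-suc : ∀ k w → φ^ (suc k) w ≡ φ^ k (φ w)
φ^-suc zero    w = refl
φ^-suc (suc k) w = cong φ (φ^-suc k w)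

length-φ : ∀ w → length (φ w) ≡ 2 * length w
length-φ []      = refl
length-φ (x ∷ w) = trans (cong (2 +_) (length-φ w)) (sym (*-suc 2 (length w)))

length-φ^ : ∀ k w → length (φ^ k w) ≡ 2 ^ k * length w
length-φ^ zero    w = sym (+-identityʳ (length w))
length-φ^ (suc k) w = begin
  length (φ (φ^ k w))      ≡⟨ length-φ (φ^ k w) ⟩
  2 * length (φ^ k w)      ≡⟨ cong (2 *_) (length-φ^ k w) ⟩
  2 * (2 ^ k * length w)   ≡⟨ *-assoc 2 (2 ^ k) (length w) ⟨
  2 ^ suc k * length w     ∎

at-++ˡ : ∀ u v {n} → n < length u → at (u ++ v) n ≡ at u n
at-++ˡ (x ∷ u) v {zero}  _         = refl
at-++ˡ (x ∷ u) v {suc n} (s≤s n<u) = at-++ˡ u v n<u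

at-++ʳ : ∀ u v n → at (u ++ v) (length u + n) ≡ at v n
at-++ʳ []      v n = refl
at-++ʳ (x ∷ u) v n = at-++ʳ u v n

at-map-not : ∀ w {n} → n < length w → at (map not w) n ≡ not (at w n)
at-map-not (x ∷ w) {zero}  _         = refl
at-map-not (x ∷ w) {suc n} (s≤s n<w) = at-map-not w n<w

at-φ-even : ∀ w {n} → n < length w → at (φ w) (n + n) ≡ at w n
at-φ-even (x ∷ w) {zero}  _ = refl
at-φ-even (x ∷ w) {suc n} (s≤s n<w) rewrite +-suc n n = at-φ-even w n<w

at-φ-odd : ∀ w {n} → n < length w → at (φ w) (suc (n + n)) ≡ not (at w n)
at-φ-odd (x ∷ w) {zero}  _ = refl
at-φ-odd (x ∷ w) {suc n} (s≤s n<w) rewrite +-suc n n = at-φ-odd w n<w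

2^suc : ∀ k → 2 ^ suc k ≡ 2 ^ k + 2 ^ k
2^suc k = cong (2 ^ k +_) (+-identityʳ (2 ^ k))

n<2^n : ∀ n → n < 2 ^ n
n<2^n zero    = z<s
n<2^n (suc n) = subst (suc (suc n) ≤_) (sym (2^suc n)) (+-mono-≤ (m^n>0 2 n) (n<2^n n))

tPrefix : ℕ → Word
tPrefix k = φ^ k (false ∷ [])

length-tPrefix : ∀ k → length (tPrefix k) ≡ 2 ^ k
length-tPrefix k = trans (length-φ^ k (false ∷ [])) (*-identityʳ (2 ^ k))

<2^⇒<length-tPrefix : ∀ k {n} → n < 2 ^ k → n < length (tPrefix k)
<2^⇒<length-tPrefix k = subst (_ <_) (sym (length-tPrefix k))

tPrefix-suc : ∀ k → tPrefix (suc k) ≡ tPrefix k ++ map not (tPrefix k)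
tPrefix-suc k = begin
  φ^ (suc k) (false ∷ [])                   ≡⟨ φ^-suc k (false ∷ []) ⟩
  φ^ k ((false ∷ []) ++ (true ∷ []))        ≡⟨ φ^-++ k (false ∷ []) (true ∷ []) ⟩
  tPrefix k ++ φ^ k (map not (false ∷ []))  ≡⟨ cong (tPrefix k ++_) (φ^-map-not k (false ∷ [])) ⟩
  tPrefix k ++ map not (tPrefix k)          ∎

at-tPrefix-suc : ∀ k {n} → n < 2 ^ k → at (tPrefix (suc k)) n ≡ at (tPrefix k) n
at-tPrefix-suc k {n} n<2^k = begin
  at (tPrefix (suc k)) n                    ≡⟨ cong (λ w → at w n) (tPrefix-suc k) ⟩
  at (tPrefix k ++ map not (tPrefix k)) n   ≡⟨ at-++ˡ (tPrefix k) _ (<2^⇒<length-tPrefix k n<2^k) ⟩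
  at (tPrefix k) n                          ∎

at-tPrefix-mono : ∀ {k l n} → k ≤′ l → n < 2 ^ k → at (tPrefix l) n ≡ at (tPrefix k) n
at-tPrefix-mono ≤′-refl             _       = refl
at-tPrefix-mono {k} (≤′-step {l} k≤′l) n<2^k =
  trans (at-tPrefix-suc l (<-≤-trans n<2^k (^-monoʳ-≤ 2 (≤′⇒≤ k≤′l))))
        (at-tPrefix-mono k≤′l n<2^k)

at-tPrefix : ∀ k {n} → n < 2 ^ k → at (tPrefix k) n ≡ t n
at-tPrefix k {n} n<2^k with ≤-total k (suc n)
... | inj₁ k≤1+n = sym (at-tPrefix-mono (≤⇒≤′ k≤1+n) n<2^k)
... | inj₂ 1+n≤k = at-tPrefix-mono (≤⇒≤′ 1+n≤k) (<-trans (n<1+n n) (n<2^n (suc n)))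

t-even : ∀ n → t (n + n) ≡ t n
t-even n = begin
  t (n + n)                   ≡⟨ at-tPrefix (suc n) n+n<2^[1+n] ⟨
  at (φ (tPrefix n)) (n + n)  ≡⟨ at-φ-even (tPrefix n) (<2^⇒<length-tPrefix n (n<2^n n)) ⟩
  at (tPrefix n) n            ≡⟨ at-tPrefix n (n<2^n n) ⟩
  t n                         ∎
  where
  n+n<2^[1+n] : n + n < 2 ^ suc n
  n+n<2^[1+n] = subst (n + n <_) (sym (2^suc n)) (+-mono-< (n<2^n n) (n<2^n n))

t-odd : ∀ n → t (suc (n + n)) ≡ not (t n)
t-odd n = begin
  t (suc (n + n))                   ≡⟨ at-tPrefix (suc n) 1+n+n<2^[1+n] ⟨
  at (φ (tPrefix n)) (suc (n + n))  ≡⟨ at-φ-odd (tPrefix n) (<2^⇒<length-tPrefix n (n<2^n n)) ⟩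
  not (at (tPrefix n) n)            ≡⟨ cong not (at-tPrefix n (n<2^n n)) ⟩
  not (t n)                         ∎
  where
  1+n+n<2^[1+n] : suc (n + n) < 2 ^ suc n
  1+n+n<2^[1+n] = subst₂ _≤_ (cong suc (+-suc n n)) (sym (2^suc n)) (+-mono-≤ (n<2^n n) (n<2^n n))

t-complement : ∀ N {y} → y < 2 ^ N → t (2 ^ N + y) ≡ not (t y)
t-complement N {y} y<2^N = begin
  t (2 ^ N + y)                                                   ≡⟨ at-tPrefix (suc N) 2^N+y<2^[1+N] ⟨
  at (tPrefix (suc N)) (2 ^ N + y)                                ≡⟨ cong₂ at (tPrefix-suc N) (cong (_+ y) (sym (length-tPrefix N))) ⟩
  at (tPrefix N ++ map not (tPrefix N)) (length (tPrefix N) + y)  ≡⟨ at-++ʳ (tPrefix N) _ y ⟩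
  at (map not (tPrefix N)) y                                      ≡⟨ at-map-not (tPrefix N) (<2^⇒<length-tPrefix N y<2^N) ⟩
  not (at (tPrefix N) y)                                          ≡⟨ cong not (at-tPrefix N y<2^N) ⟩
  not (t y)                                                       ∎
  where
  2^N+y<2^[1+N] : 2 ^ N + y < 2 ^ suc N
  2^N+y<2^[1+N] = subst (2 ^ N + y <_) (sym (2^suc N)) (+-monoʳ-< (2 ^ N) y<2^N)

data Parity : ℕ → Set where
  even : ∀ q → Parity (q + q)
  odd  : ∀ q → Parity (suc (q + q))

parity : ∀ n → Parity n
parity zero = even zero
parity (suc n) with parity n
... | even q = odd q
... | odd q  = subst Parity (cong suc (+-suc q q)) (even (suc q))

-- t(2e + 2r) = t(e + r) and t(2e + 2r + 1) = ¬t(e + r) reduce distances 2r and 2r + 1 to r.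
xor-at-distance : ∀ d c → ∃[ e ] t (e + suc d) ≡ c xor t e
xor-at-distance = <-rec _ step
  where
  step : ∀ d → (∀ {d′} → d′ < d → ∀ c → ∃[ e ] t (e + suc d′) ≡ c xor t e) →
         ∀ c → ∃[ e ] t (e + suc d) ≡ c xor t e
  step d rec c with parity d
  step _ rec false | even zero = 1 , t-even 1
  step _ rec true  | even zero = 0 , t-odd 0
  step _ rec c | even (suc r) with rec (m≤m+n (suc r) (suc r)) (not c)
  ... | e , h = e + e , (begin
    t (e + e + suc (suc r + suc r))  ≡⟨ cong t (trans (+-suc (e + e) _) (cong suc (interchange e e (suc r) (suc r)))) ⟩
    t (suc ((e + suc r) + (e + suc r))) ≡⟨ t-odd (e + suc r) ⟩
    not (t (e + suc r))              ≡⟨ cong not h ⟩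
    not (not c xor t e)              ≡⟨ not-distribˡ-xor (not c) (t e) ⟩
    not (not c) xor t e              ≡⟨ cong₂ _xor_ (not-involutive c) (sym (t-even e)) ⟩
    c xor t (e + e)                  ∎)
  step _ rec c | odd q with rec (s≤s (m≤m+n q q)) c
  ... | e , h = e + e , (begin
    t (e + e + suc (suc (q + q)))    ≡⟨ cong t (trans (cong (e + e +_) (cong suc (sym (+-suc q q)))) (interchange e e (suc q) (suc q))) ⟩
    t ((e + suc q) + (e + suc q))    ≡⟨ t-even (e + suc q) ⟩
    t (e + suc q)                    ≡⟨ h ⟩
    c xor t e                        ≡⟨ cong (c xor_) (sym (t-even e)) ⟩
    c xor t (e + e)                  ∎)

xor-complement-cases : ∀ a b x →
  (x ≡ a × (a xor b) xor x ≡ b) ⊎ (not x ≡ a × not ((a xor b) xor x) ≡ b)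
xor-complement-cases false false false = inj₁ (refl , refl)
xor-complement-cases false false true  = inj₂ (refl , refl)
xor-complement-cases false true  false = inj₁ (refl , refl)
xor-complement-cases false true  true  = inj₂ (refl , refl)
xor-complement-cases true  false false = inj₂ (refl , refl)
xor-complement-cases true  false true  = inj₁ (refl , refl)
xor-complement-cases true  true  false = inj₂ (refl , refl)
xor-complement-cases true  true  true  = inj₁ (refl , refl)

pair-at-distance : ∀ d a b → ∃[ i ] (t i ≡ a × t (i + suc d) ≡ b)
pair-at-distance d a b with xor-at-distance d (a xor b)
... | e , h with xor-complement-cases a b (t e)
... | inj₁ (tₑ≡a , eq) = e , tₑ≡a , trans h eq
... | inj₂ (¬tₑ≡a , eq) = 2 ^ N + e , trans (t-complement N e<2^N) ¬tₑ≡a , (begin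
  t (2 ^ N + e + suc d)    ≡⟨ cong t (+-assoc (2 ^ N) e (suc d)) ⟩
  t (2 ^ N + (e + suc d))  ≡⟨ t-complement N (n<2^n N) ⟩
  not (t (e + suc d))      ≡⟨ cong not h ⟩
  not ((a xor b) xor t e)  ≡⟨ eq ⟩
  b                        ∎)
  where
  N = e + suc d
  e<2^N : e < 2 ^ N
  e<2^N = <-trans (m<m+n e z<s) (n<2^n N)

OccursAt : Word → ℕ → Set
OccursAt []      i = ⊤
OccursAt (x ∷ w) i = t i ≡ x × OccursAt w (suc i)

Occurs : Word → Set
Occurs w = ∃[ i ] OccursAt w i

occursAt-φ : ∀ w {i} → OccursAt w i → OccursAt (φ w) (i + i)
occursAt-φ []      _              = tt
occursAt-φ (x ∷ w) {i} (tᵢ≡x , o) =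
  trans (t-even i) tᵢ≡x , trans (t-odd i) (cong not tᵢ≡x) ,
  subst (OccursAt (φ w)) (cong suc (+-suc i i)) (occursAt-φ w o)

occurs-φ^ : ∀ k {w} → Occurs w → Occurs (φ^ k w)
occurs-φ^ zero    o       = o
occurs-φ^ (suc k) o with occurs-φ^ k o
... | i , oᵢ = i + i , occursAt-φ _ oᵢ

occursAt-++⁻ˡ : ∀ u {v i} → OccursAt (u ++ v) i → OccursAt u i
occursAt-++⁻ˡ []      _        = tt
occursAt-++⁻ˡ (x ∷ u) (eq , o) = eq , occursAt-++⁻ˡ u o

occurs-++⁻ʳ : ∀ u {v} → Occurs (u ++ v) → Occurs v
occurs-++⁻ʳ []      o             = o
occurs-++⁻ʳ (x ∷ u) (i , (_ , o)) = occurs-++⁻ʳ u (suc i , o)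

occurs-infix : ∀ u v {w} → Occurs (u ++ w ++ v) → Occurs w
occurs-infix u v {w} o with occurs-++⁻ʳ u o
... | i , oᵢ = i , occursAt-++⁻ˡ w oᵢ

occursAt⇒factor : ∀ w {i} → OccursAt w i → ∀ (j : Fin (length w)) → at w (toℕ j) ≡ t (i + toℕ j)
occursAt⇒factor (x ∷ w) {i} (tᵢ≡x , _) zero    = sym (trans (cong t (+-identityʳ i)) tᵢ≡x)
occursAt⇒factor (x ∷ w) {i} (_ , o)    (suc j) = trans (occursAt⇒factor w o j) (cong t (sym (+-suc i (toℕ j))))

occurs⇒isFactorOfT : ∀ {w} → Occurs w → IsFactorOfT w
occurs⇒isFactorOfT {w} (i , o) = i , occursAt⇒factor w o

tWindow : ℕ → (m : ℕ) → Vec Letter m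
tWindow i zero    = []
tWindow i (suc m) = t i ∷ tWindow (suc i) m

occursAt-tWindow-++ : ∀ i m {w} → OccursAt w (i + m) → OccursAt (toList (tWindow i m) ++ w) i
occursAt-tWindow-++ i zero    {w} o = subst (OccursAt w) (+-identityʳ i) o
occursAt-tWindow-++ i (suc m) {w} o = refl , occursAt-tWindow-++ (suc i) m (subst (OccursAt w) (+-suc i m) o)

proposition5p1 : (k m : ℕ) (a b : Bool) (p s : List Bool) →
    IsSuffix p (φ^ k (a ∷ [])) → IsPrefix s (φ^ k (b ∷ [])) →
    Σ[ z ∈ Vec Bool m ] IsFactorOfT (p ++ φ^ k (toList z) ++ s)
proposition5p1 k m a b p s (u , u++p≡φᵏa) (v , s++v≡φᵏb) with pair-at-distance m a b
... | i , tᵢ≡a , tᵢ₊ₘ₊₁≡b =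
  z , occurs⇒isFactorOfT (occurs-infix u v (subst Occurs image (occurs-φ^ k (i , azb-occurs))))
  where
  z : Vec Bool m
  z = tWindow (suc i) m

  azb-occurs : OccursAt (a ∷ toList z ++ b ∷ []) i
  azb-occurs = tᵢ≡a , occursAt-tWindow-++ (suc i) m (subst (λ n → t n ≡ b) (+-suc i m) tᵢ₊ₘ₊₁≡b , tt)

  image : φ^ k ((a ∷ []) ++ toList z ++ b ∷ []) ≡ u ++ (p ++ φ^ k (toList z) ++ s) ++ v
  image = begin
    φ^ k ((a ∷ []) ++ toList z ++ b ∷ [])                ≡⟨ φ^-++ k (a ∷ []) _ ⟩
    φ^ k (a ∷ []) ++ φ^ k (toList z ++ b ∷ [])           ≡⟨ cong (φ^ k (a ∷ []) ++_) (φ^-++ k (toList z) _) ⟩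
    φ^ k (a ∷ []) ++ φ^ k (toList z) ++ φ^ k (b ∷ [])    ≡⟨ cong₂ (λ x y → x ++ φ^ k (toList z) ++ y) u++p≡φᵏa s++v≡φᵏb ⟨
    (u ++ p) ++ φ^ k (toList z) ++ s ++ v                ≡⟨ ++-assoc u p _ ⟩
    u ++ p ++ φ^ k (toList z) ++ s ++ v                  ≡⟨ cong (λ x → u ++ p ++ x) (++-assoc (φ^ k (toList z)) s v) ⟨
    u ++ p ++ (φ^ k (toList z) ++ s) ++ v                ≡⟨ cong (u ++_) (++-assoc p _ v) ⟨
    u ++ (p ++ φ^ k (toList z) ++ s) ++ v                ∎
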